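{- Fix $\alpha = \frac{A}{2C}\tau + \frac{a}{4}$, such that $A,a \in \mathbb{Z}$, $C\in \mathbb{N}$, $0 \leq a \leq 3$, and $\gcd(A,C)=1$, and let $\tau\in\mathbb{H}$. Then both $\tilde{u}_{\gamma,\tau} - u_{\tau}, \tilde{v}_{\gamma,\tau} - v_{\tau}\in \mathbb{Z}\tau +\mathbb{Z}$ if and only if $\gamma\in A_{\alpha}$.
   Context: Here $u_\tau := 2\alpha = \frac{A}{C}\tau+\frac a2$ and $v_\tau := \frac{\tau}{2}$. For a complex function $x_\tau$ of $\tau$ and $\gamma = \begin{pmatrix}a'&b'\\c'&d'\end{pmatrix}\in\mathrm{SL}_2(\mathbb{Z})$, $\tilde{x}_{\gamma,\tau} := x_{\gamma\tau}\cdot (c'\tau +d')$. $\Gamma^0(N)$ and $\Gamma^1(N)$ denote the "lower triangular" versions of $\Gamma_0(N)$ and $\Gamma_1(N)$ (i.e. $\Gamma^0(N)$: upper-right entry $\equiv 0 \pmod N$; $\Gamma^1(N)$: matrices $\equiv \begin{pmatrix}1&0\\ *&1\end{pmatrix}\pmod N$). The groups $A_\alpha$ are: $\Gamma^1(\mathrm{lcm}(2,C))$ if $a\in\{0,2\}$; $\Gamma^1(\mathrm{lcm}(2,C))\cap\Gamma_0(2)$ if $a\in\{1,3\}$ and $C\not\equiv 0\pmod 4$; and $\left(\Gamma^1(C)\cap \Gamma_0(2)\right) \cup \left(\left(\Gamma^1(\frac{C}{2})\cap\Gamma^0(C)\right)\setminus\left(\Gamma_0(2)\cup\Gamma^1(C)\right)\right)$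 if $a\in\{1,3\}$ and $C\equiv 0\pmod 4$. -}

module Defs where

open import Data.Nat as ℕ using (ℕ; NonZero)
open import Data.Nat.Divisibility using () renaming (_∣_ to _∣ℕ_)
open import Data.Nat.LCM using (lcm)
open import Data.Nat.DivMod as ND using ()
open import Data.Integer as ℤ using (ℤ; +_; _-_)
open import Data.Integer.Divisibility using (_∣_)
open import Data.Rational as ℚ using (ℚ; _/_)
open import Data.Product using (Σ; ∃-syntax; _×_; _,_; proj₁; proj₂)
open import Data.Sum using (_⊎_)
open import Relation.Nullary using (¬_)
open import Relation.Binary.PropositionalEquality using (_≡_)

record SL2 : Set where
  constructor mat
  field
    a b c d : ℤ
    det     : a ℤ.* d - b ℤ.* c ≡ + 1

open SL2 public

_≡_[mod_] : ℤ → ℤ → ℕ → Set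
x ≡ y [mod N ] = (+ N) ∣ (x - y)

Γ₀ : ℕ → SL2 → Set
Γ₀ N γ = c γ ≡ + 0 [mod N ]

Γ⁰ : ℕ → SL2 → Set
Γ⁰ N γ = b γ ≡ + 0 [mod N ]

Γ¹ : ℕ → SL2 → Set
Γ¹ N γ = (a γ ≡ + 1 [mod N ]) × (b γ ≡ + 0 [mod N ]) × (d γ ≡ + 1 [mod N ])

-- The group A_α; it depends only on a and C.
Aα : (a : ℤ) (C : ℕ) → SL2 → Set
Aα a C γ =
    ((a ≡ + 0 ⊎ a ≡ + 2) × Γ¹ (lcm 2 C) γ)
  ⊎ ((a ≡ + 1 ⊎ a ≡ + 3) × ¬ (4 ∣ℕ C) × Γ¹ (lcm 2 C) γ × Γ₀ 2 γ)
  ⊎ ((a ≡ + 1 ⊎ a ≡ + 3) × (4 ∣ℕ C) ×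
       ( (Γ¹ C γ × Γ₀ 2 γ)
       ⊎ ((Γ¹ (C ND./ 2) γ × Γ⁰ C γ) × ¬ (Γ₀ 2 γ ⊎ Γ¹ C γ))))

-- Elements of ℚτ + ℚ ⊂ ℂ, for τ ∈ ℍ.  Since τ ∉ ℝ, 1 and τ are
-- ℝ-linearly independent, so  p τ + q  is determined by (p , q).
-- A pair (p , q) stands for the complex number p·τ + q.

Lin : Set
Lin = ℚ × ℚ

infixl 6 _-L_
_-L_ : Lin → Lin → Lin
(p , q) -L (p′ , q′) = (p ℚ.- p′ , q ℚ.- q′)

ι : ℤ → ℚ
ι k = k / 1

IsInt : ℚ → Set
IsInt x = ∃[ k ] x ≡ ι k

InLattice : Lin → Set
InLattice (p , q) = IsInt p × IsInt q

-- For a function x_τ = p τ + q, the transformed function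
--   x̃_{γ,τ} = x_{γτ} (c'τ + d') = p (a'τ + b') + q (c'τ + d')
--           = (p a' + q c') τ + (p b' + q d').
tilde : SL2 → Lin → Lin
tilde γ (p , q) = ( p ℚ.* ι (a γ) ℚ.+ q ℚ.* ι (c γ)
                  , p ℚ.* ι (b γ) ℚ.+ q ℚ.* ι (d γ) )

-- u_τ = 2α = (A/C) τ + a/2
u : (A a : ℤ) (C : ℕ) → .{{NonZero C}} → Lin
u A a C = (A / C , a / 2)

v : Lin
v = (+ 1 / 2 , + 0 / 1)

{-# OPTIONS --safe #-}

-- Write γ = (a' b' ; c' d').  Clearing denominators, the v-condition says 2 ∣ a' - 1 and 2 ∣ b',
-- and the u-condition says 2C ∣ 2A(a' - 1) + a c' C and 2C ∣ 2A b' + a (d' - 1) C.  The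
-- determinant then gives 2 ∣ d' - 1, so by gcd(A, C) = 1 the second u-condition is just C ∣ b'.
-- If a c' is even, the first one is C ∣ a' - 1, and γ ∈ Γ¹(lcm(2, C)).  If a and c' are both
-- odd, reducing modulo 2 twice forces 4 ∣ C, and the first condition then says that C/2 divides
-- a' - 1 with odd quotient (A being odd): γ ∈ Γ¹(C/2) ∩ Γ⁰(C) but γ ∉ Γ¹(C).

module Submission where

open import Defs
open import Data.Nat using (ℕ; NonZero)
open import Data.Nat.GCD using (gcd)
open import Data.Integer using (ℤ; +_; _≤_; ∣_∣)
open import Data.Product using (_×_)
open import Function.Bundles using (_⇔_)
open import Relation.Binary.PropositionalEquality using (_≡_)

import Data.Nat as ℕ
import Data.Nat.Properties as ℕ
import Data.Nat.Divisibility as ℕ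
import Data.Nat.DivMod as ℕ
open import Data.Nat.Coprimality using (gcd≡1⇒coprime; 1-coprimeTo)
open import Data.Nat.Primality using (Prime; prime[2]; euclidsLemma)
open import Data.Nat.LCM using (lcm; lcm-least; n∣lcm[m,n]; m∣lcm[m,n])
open import Data.Integer as ℤ using (_+_; _-_; _*_; -_; 0ℤ; 1ℤ; -[1+_]; +≤+)
import Data.Integer.Properties as ℤ
open import Data.Integer.DivMod using (_%ℕ_; _/ℕ_; n%ℕd<d; a≡a%ℕn+[a/ℕn]*n)
open import Data.Integer.Divisibility.Signed
open import Data.Integer.Coprimality using (Coprime; coprime-divisor) renaming (sym to coprime-sym)
open import Data.Integer.Tactic.RingSolver using (solve-∀)
open import Data.Rational as ℚ using (ℚ; _/_; toℚᵘ; 1ℚ)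
import Data.Rational.Properties as ℚ
open import Data.Rational.Unnormalised as ℚᵘ using (mkℚᵘ; *≡*; _≃_)
import Data.Rational.Unnormalised.Properties as ℚᵘ
open import Data.Product using (_,_; proj₁; proj₂)
open import Data.Product.Function.NonDependent.Propositional using (_×-⇔_)
open import Data.Sum using (_⊎_; inj₁; inj₂; [_,_]′)
import Data.Sum as Sum
open import Data.Maybe using (nothing)
open import Function.Base using (_∘_)
open import Function.Bundles using (mk⇔; module Equivalence)
import Function.Properties.Equivalence as ⇔
open import Relation.Nullary using (¬_; yes; no)
open import Relation.Nullary.Decidable using (from-no)
open import Relation.Nullary.Negation using (contradiction)
open import Relation.Binary.PropositionalEquality
  using (refl; sym; trans; cong; cong₂; subst; module ≡-Reasoning)
import Tactic.RingSolver as RingSolver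
import Tactic.RingSolver.Core.AlmostCommutativeRing as ACR
open import Level using (0ℓ)

open Equivalence using (to; from)

ℚ-ring : ACR.AlmostCommutativeRing 0ℓ 0ℓ
ℚ-ring = ACR.fromCommutativeRing ℚ.+-*-commutativeRing (λ _ → nothing)

toℚᵘ-/ : ∀ n d .{{_ : NonZero d}} → toℚᵘ (n / d) ≃ mkℚᵘ n (ℕ.pred d)
toℚᵘ-/ n (ℕ.suc d) = ℚ.toℚᵘ-fromℚᵘ (mkℚᵘ n d)

ι-injective : ∀ {m n} → ι m ≡ ι n → m ≡ n
ι-injective {m} {n} ιm≡ιn
  with ℚᵘ.≃-trans (ℚᵘ.≃-sym (toℚᵘ-/ m 1)) (ℚᵘ.≃-trans (ℚ.toℚᵘ-cong ιm≡ιn) (toℚᵘ-/ n 1))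
... | *≡* m*1≡n*1 = trans (sym (ℤ.*-identityʳ m)) (trans m*1≡n*1 (ℤ.*-identityʳ n))

ι-homo-+ : ∀ m n → ι (m + n) ≡ ι m ℚ.+ ι n
ι-homo-+ m n = ℚ.toℚᵘ-injective (begin
  toℚᵘ (ι (m + n))            ≈⟨ toℚᵘ-/ (m + n) 1 ⟩
  mkℚᵘ (m + n) 0              ≈⟨ *≡* (normalise m n) ⟩
  mkℚᵘ m 0 ℚᵘ.+ mkℚᵘ n 0      ≈⟨ ℚᵘ.+-cong (toℚᵘ-/ m 1) (toℚᵘ-/ n 1) ⟨
  toℚᵘ (ι m) ℚᵘ.+ toℚᵘ (ι n)  ≈⟨ ℚ.toℚᵘ-homo-+ (ι m) (ι n) ⟨
  toℚᵘ (ι m ℚ.+ ι n)          ∎)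
  where
  open ℚᵘ.≃-Reasoning
  normalise : ∀ m n → (m + n) * + 1 ≡ (m * + 1 + n * + 1) * + 1
  normalise = solve-∀

ι-homo-* : ∀ m n → ι (m * n) ≡ ι m ℚ.* ι n
ι-homo-* m n = ℚ.toℚᵘ-injective (begin
  toℚᵘ (ι (m * n))            ≈⟨ toℚᵘ-/ (m * n) 1 ⟩
  mkℚᵘ m 0 ℚᵘ.* mkℚᵘ n 0      ≈⟨ ℚᵘ.*-cong (toℚᵘ-/ m 1) (toℚᵘ-/ n 1) ⟨
  toℚᵘ (ι m) ℚᵘ.* toℚᵘ (ι n)  ≈⟨ ℚ.toℚᵘ-homo-* (ι m) (ι n) ⟨
  toℚᵘ (ι m ℚ.* ι n)          ∎)
  where open ℚᵘ.≃-Reasoning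

ι-homo‿- : ∀ n → ι (- n) ≡ ℚ.- ι n
ι-homo‿- n = ℚ.toℚᵘ-injective (begin
  toℚᵘ (ι (- n))   ≈⟨ toℚᵘ-/ (- n) 1 ⟩
  ℚᵘ.- mkℚᵘ n 0    ≈⟨ ℚᵘ.-‿cong (toℚᵘ-/ n 1) ⟨
  ℚᵘ.- toℚᵘ (ι n)  ≈⟨ ℚ.toℚᵘ-homo‿- (ι n) ⟨
  toℚᵘ (ℚ.- ι n)   ∎)
  where open ℚᵘ.≃-Reasoning

ι-homo-minus-1 : ∀ n → ι (n - 1ℤ) ≡ ι n ℚ.- 1ℚ
ι-homo-minus-1 n = trans (ι-homo-+ n (- 1ℤ)) (cong (ι n ℚ.+_) (ι-homo‿- 1ℤ))

/-*-cancel : ∀ n d .{{_ : NonZero d}} → (n / d) ℚ.* ι (+ d) ≡ ι n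
/-*-cancel n d@(ℕ.suc d-1) = ℚ.toℚᵘ-injective (begin
  toℚᵘ (n / d ℚ.* ι (+ d))          ≈⟨ ℚ.toℚᵘ-homo-* (n / d) (ι (+ d)) ⟩
  toℚᵘ (n / d) ℚᵘ.* toℚᵘ (ι (+ d))  ≈⟨ ℚᵘ.*-cong (toℚᵘ-/ n d) (toℚᵘ-/ (+ d) 1) ⟩
  mkℚᵘ n d-1 ℚᵘ.* mkℚᵘ (+ d) 0      ≈⟨ *≡* cross ⟩
  mkℚᵘ n 0                          ≈⟨ toℚᵘ-/ n 1 ⟨
  toℚᵘ (ι n)                        ∎)
  where
  open ℚᵘ.≃-Reasoning
  cross : n * + d * + 1 ≡ n * + (d ℕ.* 1)
  cross = trans (ℤ.*-identityʳ _) (cong (λ k → n * + k) (sym (ℕ.*-identityʳ d)))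

*-cancelʳ-≡ : ∀ {x y} z .{{_ : ℚ.NonZero z}} → x ℚ.* z ≡ y ℚ.* z → x ≡ y
*-cancelʳ-≡ {x} {y} z xz≡yz = begin
  x                        ≡⟨ ℚ.*-identityʳ x ⟨
  x ℚ.* 1ℚ                 ≡⟨ cong (x ℚ.*_) (ℚ.*-inverseʳ z) ⟨
  x ℚ.* (z ℚ.* ℚ.1/ z)     ≡⟨ ℚ.*-assoc x z (ℚ.1/ z) ⟨
  x ℚ.* z ℚ.* ℚ.1/ z       ≡⟨ cong (ℚ._* ℚ.1/ z) xz≡yz ⟩
  y ℚ.* z ℚ.* ℚ.1/ z       ≡⟨ ℚ.*-assoc y z (ℚ.1/ z) ⟩
  y ℚ.* (z ℚ.* ℚ.1/ z)     ≡⟨ cong (y ℚ.*_) (ℚ.*-inverseʳ z) ⟩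
  y ℚ.* 1ℚ                 ≡⟨ ℚ.*-identityʳ y ⟩
  y                        ∎
  where open ≡-Reasoning

IsInt⇔∣ : ∀ {x n} d .{{_ : ℤ.NonZero d}} → x ℚ.* ι d ≡ ι n → IsInt x ⇔ d ∣ n
IsInt⇔∣ {x} {n} d x*d≡n = mk⇔ to′ from′
  where
  instance
    ιd-nonZero : ℚ.NonZero (ι d)
    ιd-nonZero = ℚ.≢-nonZero (λ ιd≡0 → ℕ.≢-nonZero⁻¹ ∣ d ∣ (cong ∣_∣ (ι-injective {d} {0ℤ} ιd≡0)))
  to′ : IsInt x → d ∣ n
  to′ (k , refl) = divides k (ι-injective (trans (sym x*d≡n) (sym (ι-homo-* k d))))
  from′ : d ∣ n → IsInt x
  from′ (divides k refl) = k , *-cancelʳ-≡ (ι d) (trans x*d≡n (ι-homo-* k d))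

tilde-minus-self : ∀ γ α β → tilde γ (α , β) -L (α , β)
  ≡ (α ℚ.* ι (a γ - 1ℤ) ℚ.+ β ℚ.* ι (c γ) , α ℚ.* ι (b γ) ℚ.+ β ℚ.* ι (d γ - 1ℤ))
tilde-minus-self γ α β = cong₂ _,_
  (trans (shiftˡ α β (ι (a γ)) (ι (c γ))) (cong (λ t → α ℚ.* t ℚ.+ β ℚ.* ι (c γ)) (sym (ι-homo-minus-1 (a γ)))))
  (trans (shiftʳ α β (ι (b γ)) (ι (d γ))) (cong (λ t → α ℚ.* ι (b γ) ℚ.+ β ℚ.* t) (sym (ι-homo-minus-1 (d γ)))))
  where
  shiftˡ : ∀ α β x y → α ℚ.* x ℚ.+ β ℚ.* y ℚ.- α ≡ α ℚ.* (x ℚ.- 1ℚ) ℚ.+ β ℚ.* y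
  shiftˡ = RingSolver.solve-∀ ℚ-ring
  shiftʳ : ∀ α β x y → α ℚ.* x ℚ.+ β ℚ.* y ℚ.- β ≡ α ℚ.* x ℚ.+ β ℚ.* (y ℚ.- 1ℚ)
  shiftʳ = RingSolver.solve-∀ ℚ-ring

-- (A / c) x + w / 2 ∈ ℤ, with the denominators cleared
IsIntSum : (A c x w : ℤ) → Set
IsIntSum A c x w = + 2 * c ∣ + 2 * A * x + w * c

IsInt⇔IsIntSum : ∀ A e C .{{_ : NonZero C}} x y →
  IsInt (A / C ℚ.* ι x ℚ.+ e / 2 ℚ.* ι y) ⇔ IsIntSum A (+ C) x (e * y)
IsInt⇔IsIntSum A e C x y = IsInt⇔∣ (+ 2 * + C) {{ℤ.i*j≢0 (+ 2) (+ C)}} (begin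
  (α ℚ.* ι x ℚ.+ β ℚ.* ι y) ℚ.* ι (+ 2 * + C)
    ≡⟨ cong ((α ℚ.* ι x ℚ.+ β ℚ.* ι y) ℚ.*_) (ι-homo-* (+ 2) (+ C)) ⟩
  (α ℚ.* ι x ℚ.+ β ℚ.* ι y) ℚ.* (ι (+ 2) ℚ.* ι (+ C))
    ≡⟨ regroup α β (ι x) (ι y) (ι (+ 2)) (ι (+ C)) ⟩
  ι (+ 2) ℚ.* (α ℚ.* ι (+ C)) ℚ.* ι x ℚ.+ β ℚ.* ι (+ 2) ℚ.* ι y ℚ.* ι (+ C)
    ≡⟨ cong₂ (λ p q → ι (+ 2) ℚ.* p ℚ.* ι x ℚ.+ q ℚ.* ι y ℚ.* ι (+ C)) (/-*-cancel A C) (/-*-cancel e 2) ⟩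
  ι (+ 2) ℚ.* ι A ℚ.* ι x ℚ.+ ι e ℚ.* ι y ℚ.* ι (+ C)
    ≡⟨ cong₂ ℚ._+_ (ι-homo-*³ (+ 2) A x) (ι-homo-*³ e y (+ C)) ⟨
  ι (+ 2 * A * x) ℚ.+ ι (e * y * + C)
    ≡⟨ ι-homo-+ (+ 2 * A * x) (e * y * + C) ⟨
  ι (+ 2 * A * x + e * y * + C) ∎)
  where
  open ≡-Reasoning
  α β : ℚ
  α = A / C
  β = e / 2
  regroup : ∀ α β x y t c → (α ℚ.* x ℚ.+ β ℚ.* y) ℚ.* (t ℚ.* c)
          ≡ t ℚ.* (α ℚ.* c) ℚ.* x ℚ.+ β ℚ.* t ℚ.* y ℚ.* c
  regroup = RingSolver.solve-∀ ℚ-ring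
  ι-homo-*³ : ∀ l m n → ι (l * m * n) ≡ ι l ℚ.* ι m ℚ.* ι n
  ι-homo-*³ l m n = trans (ι-homo-* (l * m) n) (cong (ℚ._* ι n) (ι-homo-* l m))

InLattice-tilde-u⇔ : ∀ A e C .{{_ : NonZero C}} γ →
  InLattice (tilde γ (u A e C) -L u A e C)
    ⇔ (IsIntSum A (+ C) (a γ - 1ℤ) (e * c γ) × IsIntSum A (+ C) (b γ) (e * (d γ - 1ℤ)))
InLattice-tilde-u⇔ A e C γ =
  subst (λ z → InLattice z ⇔ (IsIntSum A (+ C) (a γ - 1ℤ) (e * c γ) × IsIntSum A (+ C) (b γ) (e * (d γ - 1ℤ))))
    (sym (tilde-minus-self γ (A / C) (e / 2)))
    (IsInt⇔IsIntSum A e C (a γ - 1ℤ) (c γ) ×-⇔ IsInt⇔IsIntSum A e C (b γ) (d γ - 1ℤ))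

euclidsLemmaℤ : ∀ {p} m n → Prime p → + p ∣ m * n → (+ p ∣ m) ⊎ (+ p ∣ n)
euclidsLemmaℤ {p} m n p-prime p∣m*n = Sum.map ∣ᵤ⇒∣ ∣ᵤ⇒∣
  (euclidsLemma ∣ m ∣ ∣ n ∣ p-prime (subst (p ℕ.∣_) (ℤ.abs-* m n) (∣⇒∣ᵤ p∣m*n)))

odd-∣*⇒∣ : ∀ {m n} → ¬ + 2 ∣ m → + 2 ∣ m * n → + 2 ∣ n
odd-∣*⇒∣ {m} {n} 2∤m 2∣m*n =
  Sum.fromInj₂ (λ 2∣m → contradiction 2∣m 2∤m) (euclidsLemmaℤ m n prime[2] 2∣m*n)

odd*odd : ∀ {m n} → ¬ + 2 ∣ m → ¬ + 2 ∣ n → ¬ + 2 ∣ m * n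
odd*odd 2∤m 2∤n 2∣m*n = 2∤n (odd-∣*⇒∣ 2∤m 2∣m*n)

odd⇒n≡1+[n/2]*2 : ∀ n → ¬ + 2 ∣ n → n ≡ 1ℤ + (n /ℕ 2) * + 2
odd⇒n≡1+[n/2]*2 n 2∤n with n %ℕ 2 | n%ℕd<d n 2 | a≡a%ℕn+[a/ℕn]*n n 2
... | 0 | _ | n≡0+q*2 = contradiction (divides (n /ℕ 2) (trans n≡0+q*2 (ℤ.+-identityˡ _))) 2∤n
... | 1 | _ | n≡1+q*2 = n≡1+q*2
... | ℕ.suc (ℕ.suc _) | ℕ.s≤s (ℕ.s≤s ()) | _

odd+odd : ∀ {m n} → ¬ + 2 ∣ m → ¬ + 2 ∣ n → + 2 ∣ m + n
odd+odd {m} {n} 2∤m 2∤n = divides (m /ℕ 2 + n /ℕ 2 + 1ℤ) (begin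
  m + n                                        ≡⟨ cong₂ _+_ (odd⇒n≡1+[n/2]*2 m 2∤m) (odd⇒n≡1+[n/2]*2 n 2∤n) ⟩
  (1ℤ + m /ℕ 2 * + 2) + (1ℤ + n /ℕ 2 * + 2)    ≡⟨ regroup (m /ℕ 2) (n /ℕ 2) ⟩
  (m /ℕ 2 + n /ℕ 2 + 1ℤ) * + 2                 ∎)
  where
  open ≡-Reasoning
  regroup : ∀ k l → (1ℤ + k * + 2) + (1ℤ + l * + 2) ≡ (k + l + 1ℤ) * + 2
  regroup = solve-∀

coprime-∣*⇒∣ : ∀ {A c x} → Coprime A c → c ∣ A * x → c ∣ x
coprime-∣*⇒∣ {A} {c} {x} coprime c∣A*x = ∣ᵤ⇒∣ (coprime-divisor c A x (coprime-sym {A} {c} coprime) (∣⇒∣ᵤ c∣A*x))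

coprime-even⇒odd : ∀ {A c} → Coprime A c → + 2 ∣ c → ¬ + 2 ∣ A
coprime-even⇒odd {A} {c} coprime 2∣c 2∣A with coprime (∣⇒∣ᵤ {+ 2} {A} 2∣A , ∣⇒∣ᵤ {+ 2} {c} 2∣c)
... | ()

IsIntSum-even : ∀ {A c x w} → Coprime A c → + 2 ∣ w → IsIntSum A c x w ⇔ c ∣ x
IsIntSum-even {A} {c} {x} coprime (divides z refl) = mk⇔ to′ from′
  where
  factor : ∀ A x z c → + 2 * A * x + z * + 2 * c ≡ + 2 * (A * x + z * c)
  factor = solve-∀
  c∣z*c : c ∣ z * c
  c∣z*c = ∣n⇒∣m*n z ∣-refl
  to′ : IsIntSum A c x (z * + 2) → c ∣ x
  to′ h = coprime-∣*⇒∣ {A} coprime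
    (∣m+n∣n⇒∣m (*-cancelˡ-∣ (+ 2) (subst (+ 2 * c ∣_) (factor A x z c) h)) c∣z*c)
  from′ : c ∣ x → IsIntSum A c x (z * + 2)
  from′ c∣x = subst (+ 2 * c ∣_) (sym (factor A x z c))
    (*-monoʳ-∣ (+ 2) (∣m∣n⇒∣m+n (∣n⇒∣m*n A c∣x) c∣z*c))

IsIntSum-odd⇒4∣ : ∀ {A c x w} → ¬ + 2 ∣ w → + 2 ∣ x → IsIntSum A c x w → + 4 ∣ c
IsIntSum-odd⇒4∣ {A} {c} {x} {w} 2∤w 2∣x h = 4∣c (odd-∣*⇒∣ 2∤w 2∣w*c)
  where
  2∣w*c : + 2 ∣ w * c
  2∣w*c = ∣m+n∣m⇒∣n (∣-trans (∣m⇒∣m*n c ∣-refl) h) (∣m⇒∣m*n x (∣m⇒∣m*n A ∣-refl))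
  factor : ∀ A x w k → + 2 * A * x + w * (k * + 2) ≡ + 2 * (A * x + w * k)
  factor = solve-∀
  2∣Ax+wk : ∀ k → c ≡ k * + 2 → + 2 ∣ A * x + w * k
  2∣Ax+wk k c≡k*2 = ∣-trans (∣n⇒∣m*n k ∣-refl) (*-cancelˡ-∣ (+ 2)
    (subst (+ 2 * (k * + 2) ∣_) (factor A x w k) (subst (λ c → IsIntSum A c x w) c≡k*2 h)))
  regroup : ∀ j → j * + 2 * + 2 ≡ j * + 4
  regroup = solve-∀
  4∣c : + 2 ∣ c → + 4 ∣ c
  4∣c (divides k c≡k*2) = 4∣k*2 (odd-∣*⇒∣ 2∤w 2∣wk)
    where
    2∣wk : + 2 ∣ w * k
    2∣wk = ∣m+n∣m⇒∣n (2∣Ax+wk k c≡k*2) (∣n⇒∣m*n A 2∣x)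
    4∣k*2 : + 2 ∣ k → + 4 ∣ c
    4∣k*2 (divides j k≡j*2) = divides j (trans c≡k*2 (trans (cong (_* + 2) k≡j*2) (regroup j)))

IsIntSum-odd : ∀ {A c m x w} .{{_ : ℤ.NonZero c}} → c ≡ + 2 * m → Coprime A c → ¬ + 2 ∣ w →
               IsIntSum A c x w ⇔ ((m ∣ x) × ¬ (c ∣ x))
IsIntSum-odd {A} {_} {m} {x} {w} refl coprime 2∤w = mk⇔ to′ from′
  where
  -- with x = t m the cleared sum is (A t + w) c, and A is odd because c is even
  split : ∀ {t} → x ≡ t * m → + 2 * A * x + w * (+ 2 * m) ≡ (A * t + w) * (+ 2 * m)
  split {t} refl = ring A t m w
    where ring : ∀ A t m w → + 2 * A * (t * m) + w * (+ 2 * m) ≡ (A * t + w) * (+ 2 * m)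
          ring = solve-∀
  to′ : IsIntSum A (+ 2 * m) x w → (m ∣ x) × ¬ (+ 2 * m ∣ x)
  to′ h = m∣x , c∤x m∣x
    where
    rearrange : ∀ A x → + 2 * A * x ≡ A * (+ 2 * x)
    rearrange = solve-∀
    c∣A*2x : + 2 * m ∣ A * (+ 2 * x)
    c∣A*2x = subst (+ 2 * m ∣_) (rearrange A x)
      (∣m+n∣n⇒∣m (∣-trans (∣n⇒∣m*n (+ 2) ∣-refl) h) (∣n⇒∣m*n w ∣-refl))
    m∣x : m ∣ x
    m∣x = *-cancelˡ-∣ (+ 2) (coprime-∣*⇒∣ {A} coprime c∣A*2x)
    c∤x : m ∣ x → ¬ (+ 2 * m ∣ x)
    c∤x (divides t x≡tm) c∣x = 2∤w (∣m+n∣m⇒∣n 2∣At+w (∣n⇒∣m*n A 2∣t))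
      where
      2∣At+w : + 2 ∣ A * t + w
      2∣At+w = *-cancelʳ-∣ (+ 2 * m) (subst (+ 2 * (+ 2 * m) ∣_) (split x≡tm) h)
      double : ∀ t m → + 2 * (t * m) ≡ t * (+ 2 * m)
      double = solve-∀
      2∣t : + 2 ∣ t
      2∣t = *-cancelʳ-∣ (+ 2 * m)
        (subst (+ 2 * (+ 2 * m) ∣_) (trans (cong (+ 2 *_) x≡tm) (double t m)) (*-monoʳ-∣ (+ 2) c∣x))
  from′ : (m ∣ x) × ¬ (+ 2 * m ∣ x) → IsIntSum A (+ 2 * m) x w
  from′ (divides t x≡tm , c∤x) =
    subst (+ 2 * (+ 2 * m) ∣_) (sym (split x≡tm)) (*-monoˡ-∣ (+ 2 * m) (odd+odd (odd*odd 2∤A 2∤t) 2∤w))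
    where
    2∤A : ¬ + 2 ∣ A
    2∤A = coprime-even⇒odd {A} coprime (∣m⇒∣m*n m ∣-refl)
    regroup : ∀ s m → s * + 2 * m ≡ s * (+ 2 * m)
    regroup = solve-∀
    2∤t : ¬ + 2 ∣ t
    2∤t (divides s t≡s*2) = c∤x (divides s (trans x≡tm (trans (cong (_* m) t≡s*2) (regroup s m))))

≡0[mod]⇔∣ : ∀ x {N} → x ≡ + 0 [mod N ] ⇔ + N ∣ x
≡0[mod]⇔∣ x = mk⇔ (λ h → subst (_ ∣_) (ℤ.+-identityʳ x) (∣ᵤ⇒∣ h))
                   (λ h → ∣⇒∣ᵤ (subst (_ ∣_) (sym (ℤ.+-identityʳ x)) h))

∣a-1⇒∣b⇒∣d-1 : ∀ {N} γ → N ∣ a γ - 1ℤ → N ∣ b γ → N ∣ d γ - 1ℤ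
∣a-1⇒∣b⇒∣d-1 {N} (mat p q r s det) N∣p-1 N∣q =
  subst (N ∣_) s-1≡qr-[p-1]s (∣m∣n⇒∣m-n (∣m⇒∣m*n r N∣q) (∣m⇒∣m*n s N∣p-1))
  where
  rearrange : ∀ p q r s → q * r - (p - 1ℤ) * s ≡ s - (p * s - q * r)
  rearrange = solve-∀
  s-1≡qr-[p-1]s : q * r - (p - 1ℤ) * s ≡ s - 1ℤ
  s-1≡qr-[p-1]s = trans (rearrange p q r s) (cong (λ k → s - k) det)

Γ¹⇔ : ∀ {N} γ → Γ¹ N γ ⇔ ((+ N ∣ a γ - 1ℤ) × (+ N ∣ b γ))
Γ¹⇔ γ = mk⇔ (λ (N∣a-1 , b≡0 , _) → ∣ᵤ⇒∣ N∣a-1 , to (≡0[mod]⇔∣ (b γ)) b≡0)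
            (λ (N∣a-1 , N∣b) → ∣⇒∣ᵤ N∣a-1 , from (≡0[mod]⇔∣ (b γ)) N∣b , ∣⇒∣ᵤ (∣a-1⇒∣b⇒∣d-1 γ N∣a-1 N∣b))

Γ¹-anti-mono : ∀ {M N} γ → M ℕ.∣ N → Γ¹ N γ → Γ¹ M γ
Γ¹-anti-mono γ M∣N G =
  let (N∣a-1 , N∣b) = to (Γ¹⇔ γ) G
  in from (Γ¹⇔ γ) (∣-trans (∣ᵤ⇒∣ M∣N) N∣a-1 , ∣-trans (∣ᵤ⇒∣ M∣N) N∣b)

lcm-∣⇔ : ∀ {m n x} → + lcm m n ∣ x ⇔ ((+ m ∣ x) × (+ n ∣ x))
lcm-∣⇔ {m} {n} = mk⇔ (λ h → ∣-trans (∣ᵤ⇒∣ (m∣lcm[m,n] m n)) h , ∣-trans (∣ᵤ⇒∣ (n∣lcm[m,n] m n)) h)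
                     (λ (m∣x , n∣x) → ∣ᵤ⇒∣ (lcm-least (∣⇒∣ᵤ m∣x) (∣⇒∣ᵤ n∣x)))

4∣n⇒n≡2*[n/2]×2∣n/2 : ∀ {n} → 4 ℕ.∣ n → (+ n ≡ + 2 * + (n ℕ./ 2)) × (+ 2 ∣ + (n ℕ./ 2))
4∣n⇒n≡2*[n/2]×2∣n/2 {n} 4∣n =
  trans (cong +_ n≡2*[n/2]) (ℤ.pos-* 2 (n ℕ./ 2)) ,
  ∣ᵤ⇒∣ (ℕ.*-cancelˡ-∣ 2 (subst (4 ℕ.∣_) n≡2*[n/2] 4∣n))
  where
  n≡2*[n/2] : n ≡ 2 ℕ.* (n ℕ./ 2)
  n≡2*[n/2] = sym (ℕ.m*[n/m]≡n (ℕ.∣-trans (ℕ.divides 2 refl) 4∣n))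

Aᵒᵈᵈ : ℕ → SL2 → Set
Aᵒᵈᵈ C γ = (¬ (4 ℕ.∣ C) × Γ¹ (lcm 2 C) γ × Γ₀ 2 γ)
         ⊎ ((4 ℕ.∣ C) × ((Γ¹ C γ × Γ₀ 2 γ) ⊎ ((Γ¹ (C ℕ./ 2) γ × Γ⁰ C γ) × ¬ (Γ₀ 2 γ ⊎ Γ¹ C γ))))

0≤n≤3⇒even⊎odd : ∀ {n} → + 0 ≤ n → n ≤ + 3 → (n ≡ + 0 ⊎ n ≡ + 2) ⊎ (n ≡ + 1 ⊎ n ≡ + 3)
0≤n≤3⇒even⊎odd {+ 0} _ _ = inj₁ (inj₁ refl)
0≤n≤3⇒even⊎odd {+ 1} _ _ = inj₂ (inj₁ refl)
0≤n≤3⇒even⊎odd {+ 2} _ _ = inj₁ (inj₂ refl)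
0≤n≤3⇒even⊎odd {+ 3} _ _ = inj₂ (inj₂ refl)
0≤n≤3⇒even⊎odd {+ ℕ.suc (ℕ.suc (ℕ.suc (ℕ.suc _)))} _ (+≤+ (ℕ.s≤s (ℕ.s≤s (ℕ.s≤s ()))))
0≤n≤3⇒even⊎odd { -[1+ _ ]} () _

n≡0⊎n≡2⇒2∣n : ∀ {n} → n ≡ + 0 ⊎ n ≡ + 2 → + 2 ∣ n
n≡0⊎n≡2⇒2∣n (inj₁ refl) = divides 0ℤ refl
n≡0⊎n≡2⇒2∣n (inj₂ refl) = divides 1ℤ refl

n≡1⊎n≡3⇒2∤n : ∀ {n} → n ≡ + 1 ⊎ n ≡ + 3 → ¬ + 2 ∣ n
n≡1⊎n≡3⇒2∤n (inj₁ refl) = from-no (+ 2 ∣? + 1)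
n≡1⊎n≡3⇒2∤n (inj₂ refl) = from-no (+ 2 ∣? + 3)

Aα-even : ∀ {e} C γ → e ≡ + 0 ⊎ e ≡ + 2 → Aα e C γ ⇔ Γ¹ (lcm 2 C) γ
Aα-even {e} C γ even = mk⇔ to′ (λ G → inj₁ (even , G))
  where
  to′ : Aα e C γ → Γ¹ (lcm 2 C) γ
  to′ (inj₁ (_ , G)) = G
  to′ (inj₂ (inj₁ (odd , _))) = contradiction (n≡0⊎n≡2⇒2∣n even) (n≡1⊎n≡3⇒2∤n odd)
  to′ (inj₂ (inj₂ (odd , _))) = contradiction (n≡0⊎n≡2⇒2∣n even) (n≡1⊎n≡3⇒2∤n odd)

Aα-odd : ∀ {e} C γ → e ≡ + 1 ⊎ e ≡ + 3 → Aα e C γ ⇔ Aᵒᵈᵈ C γ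
Aα-odd {e} C γ odd = mk⇔ to′ (inj₂ ∘ Sum.map (odd ,_) (odd ,_))
  where
  to′ : Aα e C γ → Aᵒᵈᵈ C γ
  to′ (inj₁ (even , _)) = contradiction (n≡0⊎n≡2⇒2∣n even) (n≡1⊎n≡3⇒2∤n odd)
  to′ (inj₂ h) = Sum.map proj₂ proj₂ h

Aᵒᵈᵈ⇔Γ¹ : ∀ C γ → Γ₀ 2 γ → Aᵒᵈᵈ C γ ⇔ Γ¹ (lcm 2 C) γ
Aᵒᵈᵈ⇔Γ¹ C γ Γ₀2 = mk⇔ to′ from′
  where
  to′ : Aᵒᵈᵈ C γ → Γ¹ (lcm 2 C) γ
  to′ (inj₁ (_ , G , _)) = G
  to′ (inj₂ (4∣C , inj₁ (G , _))) = Γ¹-anti-mono γ (lcm-least (ℕ.∣-trans (ℕ.divides 2 refl) 4∣C) ℕ.∣-refl) G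
  to′ (inj₂ (_ , inj₂ (_ , neither))) = contradiction (inj₁ Γ₀2) neither
  from′ : Γ¹ (lcm 2 C) γ → Aᵒᵈᵈ C γ
  from′ G with 4 ℕ.∣? C
  ... | no 4∤C = inj₁ (4∤C , G , Γ₀2)
  ... | yes 4∣C = inj₂ (4∣C , inj₁ (Γ¹-anti-mono γ (n∣lcm[m,n] 2 C) G , Γ₀2))

Aᵒᵈᵈ⇔Γ¹[C/2] : ∀ C γ → ¬ Γ₀ 2 γ → Aᵒᵈᵈ C γ ⇔ ((4 ℕ.∣ C) × (Γ¹ (C ℕ./ 2) γ × Γ⁰ C γ) × ¬ Γ¹ C γ)
Aᵒᵈᵈ⇔Γ¹[C/2] C γ ¬Γ₀2 = mk⇔ to′ from′
  where
  to′ : Aᵒᵈᵈ C γ → (4 ℕ.∣ C) × (Γ¹ (C ℕ./ 2) γ × Γ⁰ C γ) × ¬ Γ¹ C γ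
  to′ (inj₁ (_ , _ , Γ₀2)) = contradiction Γ₀2 ¬Γ₀2
  to′ (inj₂ (_ , inj₁ (_ , Γ₀2))) = contradiction Γ₀2 ¬Γ₀2
  to′ (inj₂ (4∣C , inj₂ (G , neither))) = 4∣C , G , neither ∘ inj₂
  from′ : (4 ℕ.∣ C) × (Γ¹ (C ℕ./ 2) γ × Γ⁰ C γ) × ¬ Γ¹ C γ → Aᵒᵈᵈ C γ
  from′ (4∣C , G , ¬Γ¹C) = inj₂ (4∣C , inj₂ (G , [ ¬Γ₀2 , ¬Γ¹C ]′))

LatticeCondition : (A e : ℤ) (C : ℕ) → SL2 → Set
LatticeCondition A e C γ =
  (IsIntSum A (+ C) (a γ - 1ℤ) (e * c γ) × IsIntSum A (+ C) (b γ) (e * (d γ - 1ℤ)))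
  × ((+ 2 ∣ a γ - 1ℤ) × (+ 2 ∣ b γ))

InLattice⇔LatticeCondition : ∀ A e C .{{_ : NonZero C}} γ →
  (InLattice (tilde γ (u A e C) -L u A e C) × InLattice (tilde γ v -L v)) ⇔ LatticeCondition A e C γ
InLattice⇔LatticeCondition A e C γ =
  InLattice-tilde-u⇔ A e C γ
    ×-⇔ ⇔.trans (InLattice-tilde-u⇔ (+ 1) (+ 0) 2 γ) (half (a γ - 1ℤ) (c γ) ×-⇔ half (b γ) (d γ - 1ℤ))
  where
  -- v is definitionally u 1 0 2
  half : ∀ x y → IsIntSum (+ 1) (+ 2) x (+ 0 * y) ⇔ + 2 ∣ x
  half x y = IsIntSum-even {+ 1} {+ 2} {x} (1-coprimeTo 2) (∣m⇒∣m*n y (divides 0ℤ refl))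

module _ (A e : ℤ) (C : ℕ) .{{_ : NonZero C}} (coprime : Coprime A (+ C)) (γ : SL2) where

  LatticeCondition⇔reduced : LatticeCondition A e C γ ⇔
    ((IsIntSum A (+ C) (a γ - 1ℤ) (e * c γ) × (+ C ∣ b γ)) × ((+ 2 ∣ a γ - 1ℤ) × (+ 2 ∣ b γ)))
  LatticeCondition⇔reduced = mk⇔ (λ ((U₁ , U₂) , V) → (U₁ , to (U₂⇔ V) U₂) , V)
                                 (λ ((U₁ , C∣b) , V) → (U₁ , from (U₂⇔ V) C∣b) , V)
    where
    U₂⇔ : (+ 2 ∣ a γ - 1ℤ) × (+ 2 ∣ b γ) → IsIntSum A (+ C) (b γ) (e * (d γ - 1ℤ)) ⇔ (+ C ∣ b γ)
    U₂⇔ (2∣a-1 , 2∣b) = IsIntSum-even {A} {+ C} {b γ} coprime (∣n⇒∣m*n e (∣a-1⇒∣b⇒∣d-1 γ 2∣a-1 2∣b))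

  LatticeCondition⇔Γ¹ : + 2 ∣ e * c γ → LatticeCondition A e C γ ⇔ Γ¹ (lcm 2 C) γ
  LatticeCondition⇔Γ¹ 2∣ec = ⇔.trans LatticeCondition⇔reduced (mk⇔ to′ from′)
    where
    U₁⇔ : IsIntSum A (+ C) (a γ - 1ℤ) (e * c γ) ⇔ (+ C ∣ a γ - 1ℤ)
    U₁⇔ = IsIntSum-even {A} {+ C} {a γ - 1ℤ} coprime 2∣ec
    to′ : (IsIntSum A (+ C) (a γ - 1ℤ) (e * c γ) × (+ C ∣ b γ)) × ((+ 2 ∣ a γ - 1ℤ) × (+ 2 ∣ b γ))
        → Γ¹ (lcm 2 C) γ
    to′ ((U₁ , C∣b) , (2∣a-1 , 2∣b)) =
      from (Γ¹⇔ γ) (from lcm-∣⇔ (2∣a-1 , to U₁⇔ U₁) , from lcm-∣⇔ (2∣b , C∣b))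
    from′ : Γ¹ (lcm 2 C) γ
          → (IsIntSum A (+ C) (a γ - 1ℤ) (e * c γ) × (+ C ∣ b γ)) × ((+ 2 ∣ a γ - 1ℤ) × (+ 2 ∣ b γ))
    from′ G =
      let (L∣a-1 , L∣b) = to (Γ¹⇔ γ) G
          (2∣a-1 , C∣a-1) = to lcm-∣⇔ L∣a-1
          (2∣b , C∣b) = to lcm-∣⇔ L∣b
      in (from U₁⇔ C∣a-1 , C∣b) , (2∣a-1 , 2∣b)

  LatticeCondition⇔Γ¹[C/2] : ¬ + 2 ∣ e * c γ →
    LatticeCondition A e C γ ⇔ ((4 ℕ.∣ C) × (Γ¹ (C ℕ./ 2) γ × Γ⁰ C γ) × ¬ Γ¹ C γ)
  LatticeCondition⇔Γ¹[C/2] 2∤ec = ⇔.trans LatticeCondition⇔reduced (mk⇔ to′ from′)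
    where
    to′ : (IsIntSum A (+ C) (a γ - 1ℤ) (e * c γ) × (+ C ∣ b γ)) × ((+ 2 ∣ a γ - 1ℤ) × (+ 2 ∣ b γ))
        → (4 ℕ.∣ C) × (Γ¹ (C ℕ./ 2) γ × Γ⁰ C γ) × ¬ Γ¹ C γ
    to′ ((U₁ , C∣b) , (2∣a-1 , _)) =
      let 4∣C = ∣⇒∣ᵤ (IsIntSum-odd⇒4∣ {A} {+ C} {a γ - 1ℤ} 2∤ec 2∣a-1 U₁)
          (C≡2m , _) = 4∣n⇒n≡2*[n/2]×2∣n/2 4∣C
          (m∣a-1 , C∤a-1) = to (IsIntSum-odd {A} {x = a γ - 1ℤ} C≡2m coprime 2∤ec) U₁
      in 4∣C , (from (Γ¹⇔ γ) (m∣a-1 , ∣-trans (divides (+ 2) C≡2m) C∣b) , from (≡0[mod]⇔∣ (b γ)) C∣b)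
             , C∤a-1 ∘ proj₁ ∘ to (Γ¹⇔ γ)
    from′ : (4 ℕ.∣ C) × (Γ¹ (C ℕ./ 2) γ × Γ⁰ C γ) × ¬ Γ¹ C γ
          → (IsIntSum A (+ C) (a γ - 1ℤ) (e * c γ) × (+ C ∣ b γ)) × ((+ 2 ∣ a γ - 1ℤ) × (+ 2 ∣ b γ))
    from′ (4∣C , (G , Γ⁰C) , ¬Γ¹C) =
      let (C≡2m , 2∣m) = 4∣n⇒n≡2*[n/2]×2∣n/2 4∣C
          (m∣a-1 , m∣b) = to (Γ¹⇔ γ) G
          C∣b = to (≡0[mod]⇔∣ (b γ)) Γ⁰C
          C∤a-1 = λ C∣a-1 → ¬Γ¹C (from (Γ¹⇔ γ) (C∣a-1 , C∣b))
      in (from (IsIntSum-odd {A} {x = a γ - 1ℤ} C≡2m coprime 2∤ec) (m∣a-1 , C∤a-1) , C∣b)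
         , (∣-trans 2∣m m∣a-1 , ∣-trans 2∣m m∣b)

lemma3p2 : (A a : ℤ) (C : ℕ) {{_ : NonZero C}} →
    + 0 ≤ a → a ≤ + 3 → gcd ∣ A ∣ C ≡ 1 → (γ : SL2) →
    (InLattice (tilde γ (u A a C) -L u A a C) × InLattice (tilde γ v -L v))
    ⇔ Aα a C γ
lemma3p2 A a C 0≤a a≤3 gcd≡1 γ =
  ⇔.trans (InLattice⇔LatticeCondition A a C γ) (byParity (0≤n≤3⇒even⊎odd 0≤a a≤3))
  where
  coprime : Coprime A (+ C)
  coprime = gcd≡1⇒coprime gcd≡1
  byParity : (a ≡ + 0 ⊎ a ≡ + 2) ⊎ (a ≡ + 1 ⊎ a ≡ + 3) → LatticeCondition A a C γ ⇔ Aα a C γ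
  byParity (inj₁ even) =
    ⇔.trans (LatticeCondition⇔Γ¹ A a C coprime γ (∣m⇒∣m*n (c γ) (n≡0⊎n≡2⇒2∣n even)))
            (⇔.sym (Aα-even C γ even))
  byParity (inj₂ odd) with + 2 ∣? c γ
  ... | yes 2∣c =
    ⇔.trans (LatticeCondition⇔Γ¹ A a C coprime γ (∣n⇒∣m*n a 2∣c))
            (⇔.sym (⇔.trans (Aα-odd C γ odd) (Aᵒᵈᵈ⇔Γ¹ C γ (from (≡0[mod]⇔∣ (c γ)) 2∣c))))
  ... | no 2∤c =
    ⇔.trans (LatticeCondition⇔Γ¹[C/2] A a C coprime γ (odd*odd (n≡1⊎n≡3⇒2∤n odd) 2∤c))
            (⇔.sym (⇔.trans (Aα-odd C γ odd) (Aᵒᵈᵈ⇔Γ¹[C/2] C γ (2∤c ∘ to (≡0[mod]⇔∣ (c γ))))))
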